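{- Let $G_n$ be a two-tree of order $n\geq 2$. Then $$\overline{SO}(G_n)\geq \sqrt{2}(n-2)(n-3),$$ with equality if and only if $G_n\cong X_n$.
   Context: All graphs are simple. For a vertex $v$, $d(v)$ denotes its degree. The Sombor coindex of a graph $G$ is $\overline{SO}(G)=\sum_{uv\notin E(G)}\sqrt{d(u)^2+d(v)^2}$, the sum running over all unordered pairs $\{u,v\}$ of distinct non-adjacent vertices of $G$. Two-trees are defined recursively: $T_0\cong K_2$ is a two-tree, and for $t\geq 1$, a two-tree $T_t$ is obtained from a two-tree $T_{t-1}$ by adding a new vertex adjacent to both end vertices of one edge of $T_{t-1}$; a two-tree $T_t$ has $t+2$ vertices. $X_n$ denotes the graph obtained from the complete bipartite graph $K_{2,n-2}$ by adding an edge between its two vertices of degree $n-2$ (so $X_2\cong K_2$, $X_3\cong K_3$). -}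

module Defs where

open import Data.Nat as ℕ using (ℕ; zero; suc; _+_; _*_; _∸_; _^_)
open import Data.Bool using (Bool; true; false; if_then_else_; not; _∧_; _∨_)
open import Data.Fin as Fin using (Fin; zero; suc; toℕ)
open import Data.Fin.Properties using (_≟_)
open import Data.List using (List; []; _∷_; map; concatMap; replicate)
open import Data.Nat.ListAction using (sum)
open import Data.Empty using (⊥-elim)
open import Relation.Nullary using (yes; no)
open import Data.List.Base using (allFin)
open import Data.Product using (Σ; _×_; _,_)
open import Data.Integer using (+_)
open import Data.Rational as ℚ using (ℚ; 0ℚ)
open import Relation.Nullary.Decidable using (⌊_⌋)
open import Relation.Binary.PropositionalEquality using (_≡_; refl; cong; cong₂) renaming (sym to ≡-sym)
open import Function.Bundles using (_↔_; Inverse)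

record Graph (n : ℕ) : Set where
  field
    adj    : Fin n → Fin n → Bool
    sym    : ∀ i j → adj i j ≡ adj j i
    irrefl : ∀ i → adj i i ≡ false
open Graph public

deg : ∀ {n} → Graph n → Fin n → ℕ
deg {n} G v = sum (map (λ w → if adj G v w then 1 else 0) (allFin n))

_≅_ : ∀ {n} → Graph n → Graph n → Set
_≅_ {n} G H = Σ (Fin n ↔ Fin n) λ σ →
  ∀ i j → adj G i j ≡ adj H (Inverse.to σ i) (Inverse.to σ j)

-- Exact real numbers of the form  Σ √aᵢ  (aᵢ ∈ ℕ), represented by the
-- list [a₁,…,aₖ], compared via their Dedekind lower cuts.
-- Below r as  holds iff  r < Σ √aᵢ  (as a real number).

ℕ→ℚ : ℕ → ℚ
ℕ→ℚ a = + a ℚ./ 1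

Below : ℚ → List ℕ → Set
Below r []       = r ℚ.< 0ℚ
Below r (a ∷ as) = Σ ℚ λ q → (0ℚ ℚ.≤ q) × (q ℚ.* q ℚ.≤ ℕ→ℚ a) × Below (r ℚ.- q) as

_≤√_ : List ℕ → List ℕ → Set
xs ≤√ ys = ∀ r → Below r xs → Below r ys

_≈√_ : List ℕ → List ℕ → Set
xs ≈√ ys = (xs ≤√ ys) × (ys ≤√ xs)

-- Sombor coindex: the list of d(u)²+d(v)² over unordered pairs {u,v}
-- of distinct non-adjacent vertices (u < v), read as Σ √(…).

SOcoTerms : ∀ {n} → Graph n → List ℕ
SOcoTerms {n} G =
  concatMap (λ u → concatMap (λ v →
      if ⌊ u Fin.<? v ⌋ ∧ not (adj G u v)
      then (deg G u ^ 2 + deg G v ^ 2) ∷ [] else [])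
    (allFin n)) (allFin n)

private
  eqb : ∀ {n} → Fin n → Fin n → Bool
  eqb i j = ⌊ i ≟ j ⌋

K2adj : Fin 2 → Fin 2 → Bool
K2adj i j = not (eqb i j)

K2 : Graph 2
K2 = record { adj = K2adj ; sym = s ; irrefl = ir }
  where
  s : ∀ i j → K2adj i j ≡ K2adj j i
  s zero zero = refl
  s zero (suc zero) = refl
  s (suc zero) zero = refl
  s (suc zero) (suc zero) = refl
  ir : ∀ i → K2adj i i ≡ false
  ir zero = refl
  ir (suc zero) = refl

extAdj : ∀ {n} → Graph n → Fin n → Fin n → Fin (suc n) → Fin (suc n) → Bool
extAdj G a b zero    zero    = false
extAdj G a b zero    (suc j) = eqb j a ∨ eqb j b
extAdj G a b (suc i) zero    = eqb i a ∨ eqb i b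
extAdj G a b (suc i) (suc j) = adj G i j

extend : ∀ {n} → Graph n → Fin n → Fin n → Graph (suc n)
extend {n} G a b = record { adj = extAdj G a b ; sym = s ; irrefl = ir }
  where
  s : ∀ i j → extAdj G a b i j ≡ extAdj G a b j i
  s zero zero = refl
  s zero (suc j) = refl
  s (suc i) zero = refl
  s (suc i) (suc j) = sym G i j
  ir : ∀ i → extAdj G a b i i ≡ false
  ir zero = refl
  ir (suc i) = irrefl G i

data TwoTreeBuilt : (n : ℕ) → Graph n → Set where
  base : TwoTreeBuilt 2 K2
  step : ∀ {n} {G : Graph n} → TwoTreeBuilt n G →
         (a b : Fin n) → adj G a b ≡ true →
         TwoTreeBuilt (suc n) (extend G a b)

IsTwoTree : ∀ {n} → Graph n → Set
IsTwoTree {n} G = Σ (Graph n) λ H → TwoTreeBuilt n H × (G ≅ H)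

-- X_n : K_{2,n-2} plus the edge between its two vertices of degree n-2
-- (vertices 0 and 1 are the two hubs)

XAdj : ∀ {n} → Fin n → Fin n → Bool
XAdj i j = not (eqb i j) ∧ (⌊ toℕ i ℕ.<? 2 ⌋ ∨ ⌊ toℕ j ℕ.<? 2 ⌋)

X : (n : ℕ) → Graph n
X n = record { adj = XAdj ; sym = s ; irrefl = ir }
  where
  open import Data.Bool.Properties using (∨-comm)
  eqb-sym : (i j : Fin n) → eqb i j ≡ eqb j i
  eqb-sym i j with i ≟ j | j ≟ i
  ... | yes _ | yes _ = refl
  ... | no _  | no _  = refl
  ... | yes p | no q  = ⊥-elim (q (Relation.Binary.PropositionalEquality.sym p))
  ... | no p  | yes q = ⊥-elim (p (Relation.Binary.PropositionalEquality.sym q))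
  s : ∀ i j → XAdj i j ≡ XAdj j i
  s i j = cong₂ _∧_ (cong not (eqb-sym i j)) (∨-comm (⌊ toℕ i ℕ.<? 2 ⌋) (⌊ toℕ j ℕ.<? 2 ⌋))
  ir : ∀ i → XAdj i i ≡ false
  ir i with i ≟ i
  ... | yes _ = refl
  ... | no ¬p = ⊥-elim (¬p refl)

-- A two-tree on n vertices has degree sum 4n − 6, so (n − 2)(n − 3)/2 pairs of its vertices are
-- non-adjacent, and every vertex with a non-neighbour has degree at least 2. Each such pair contributes
-- √(d(u)² + d(v)²) ≥ √8 = √2 + √2, which is the bound, and equality forces d(u) = d(v) = 2 on every
-- non-adjacent pair. Along the construction such a two-tree stays isomorphic to X: the new vertex must be
-- joined to both hubs, for otherwise the hub it misses has the new vertex as a non-neighbour while its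
-- degree is at least 3 (in the triangle X₃ every edge is a hub edge up to symmetry).
-- Sums of square roots are compared through their rational lower cuts; for the strict inequality a
-- solution of the Pell equation P² + 1 = 2Q² provides a rational lying between the two sums.
module Submission where

module SumsOfSquareRoots where

  open import Defs hiding (sym)
  open import Data.Nat as ℕ using (ℕ; zero; suc; z≤n; s≤s)
  import Data.Nat.Properties as ℕ
  open import Data.Integer as ℤ using (+_)
  import Data.Integer.Properties as ℤ
  open import Data.Rational as ℚ using (ℚ; mkℚ; 0ℚ; 1ℚ; _+_; _*_; _-_; _≤_; _<_; -_; ½; 1/_)
  open import Data.Rational.Properties
  open import Data.Rational.Solver using (module +-*-Solver)
  open +-*-Solver
  import Data.Nat.Coprimality as Coprime
  open import Data.List using (List; []; _∷_; length; map; replicate)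
  open import Data.List.Properties using (length-replicate)
  open import Data.Nat.ListAction using (sum)
  open import Data.List.Relation.Unary.All as All using (All; []; _∷_)
  open import Data.List.Relation.Unary.Any as Any using (Any; here; there)
  open import Data.Product using (_×_; _,_; ∃₂; proj₁; proj₂)
  open import Data.Sum using (inj₁; inj₂)
  open import Relation.Nullary using (¬_; yes; no; contradiction)
  open import Data.Empty using (⊥)
  open import Relation.Binary.PropositionalEquality
  open import Data.Nat.Tactic.RingSolver using (solve-∀)
  open import Data.List.Relation.Unary.All.Properties using (replicate⁺)

  ℕ→ℚ≡mkℚ : ∀ a → ℕ→ℚ a ≡ mkℚ (+ a) 0 (Coprime.sym (Coprime.1-coprimeTo a))
  ℕ→ℚ≡mkℚ a = normalize-coprime (Coprime.sym (Coprime.1-coprimeTo a))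

  ℕ→ℚ-+ : ∀ a b → ℕ→ℚ (a ℕ.+ b) ≡ ℕ→ℚ a + ℕ→ℚ b
  ℕ→ℚ-+ a b rewrite ℕ→ℚ≡mkℚ a | ℕ→ℚ≡mkℚ b =
    cong₂ (λ x y → (x ℤ.+ y) ℚ./ 1) (sym (ℤ.*-identityʳ (+ a))) (sym (ℤ.*-identityʳ (+ b)))

  ℕ→ℚ-* : ∀ a b → ℕ→ℚ (a ℕ.* b) ≡ ℕ→ℚ a * ℕ→ℚ b
  ℕ→ℚ-* a b rewrite ℕ→ℚ≡mkℚ a | ℕ→ℚ≡mkℚ b = cong (ℚ._/ 1) (ℤ.pos-* a b)

  ℕ→ℚ-mono-≤ : ∀ {a b} → a ℕ.≤ b → ℕ→ℚ a ≤ ℕ→ℚ b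
  ℕ→ℚ-mono-≤ {a} {b} a≤b rewrite ℕ→ℚ≡mkℚ a | ℕ→ℚ≡mkℚ b =
    ℚ.*≤* (subst₂ ℤ._≤_ (sym (ℤ.*-identityʳ (+ a))) (sym (ℤ.*-identityʳ (+ b))) (ℤ.+≤+ a≤b))

  ℕ→ℚ-mono-< : ∀ {a b} → a ℕ.< b → ℕ→ℚ a < ℕ→ℚ b
  ℕ→ℚ-mono-< {a} {b} a<b rewrite ℕ→ℚ≡mkℚ a | ℕ→ℚ≡mkℚ b =
    ℚ.*<* (subst₂ ℤ._<_ (sym (ℤ.*-identityʳ (+ a))) (sym (ℤ.*-identityʳ (+ b))) (ℤ.+<+ a<b))

  *-nonNeg : ∀ {p q} → 0ℚ ≤ p → 0ℚ ≤ q → 0ℚ ≤ p * q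
  *-nonNeg {p} {q} 0≤p 0≤q =
    let instance _ = ℚ.nonNegative 0≤p ; _ = ℚ.nonNegative 0≤q
    in nonNegative⁻¹ _ {{nonNeg*nonNeg⇒nonNeg p q}}

  square-nonNeg : ∀ p → 0ℚ ≤ p * p
  square-nonNeg p with ≤-total 0ℚ p
  ... | inj₁ 0≤p = *-nonNeg 0≤p 0≤p
  ... | inj₂ p≤0 = let instance _ = ℚ.nonPositive p≤0 in nonNegative⁻¹ _ {{nonPos*nonPos⇒nonPos p p}}

  square-≤⇒≤ : ∀ {p q} → 0ℚ ≤ q → p * p ≤ q * q → p ≤ q
  square-≤⇒≤ {p} {q} 0≤q p²≤q² with p ≤? q
  ... | yes p≤q = p≤q
  ... | no p≰q = contradiction (<-≤-trans q²<p² p²≤q²) (<-irrefl refl)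
    where
    q<p : q < p
    q<p = ≰⇒> p≰q
    q²<p² : q * q < p * p
    q²<p² = ≤-<-trans (*-monoˡ-≤-nonNeg q {{ℚ.nonNegative 0≤q}} (<⇒≤ q<p))
                      (*-monoˡ-<-pos p {{ℚ.positive (≤-<-trans 0≤q q<p)}} q<p)

  square-+-≤ : ∀ p q → (p + q) * (p + q) ≤ (p * p + q * q) + (p * p + q * q)
  square-+-≤ p q = subst ((p + q) * (p + q) ≤_) (sym (identity p q)) x≤x+d²
    where
    x : ℚ
    x = (p + q) * (p + q)
    x≤x+d² : x ≤ x + (p - q) * (p - q)
    x≤x+d² = subst (_≤ x + (p - q) * (p - q)) (+-identityʳ x) (+-monoʳ-≤ x (square-nonNeg (p - q)))
    identity : ∀ p q → (p * p + q * q) + (p * p + q * q) ≡ (p + q) * (p + q) + (p - q) * (p - q)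
    identity = solve 2 (λ p q → (p :* p :+ q :* q) :+ (p :* p :+ q :* q)
                             := (p :+ q) :* (p :+ q) :+ (p :- q) :* (p :- q)) refl

  replicate≤√ : ∀ b L → All (4 ℕ.* b ℕ.≤_) L → replicate (length L ℕ.* 2) b ≤√ L
  replicate≤√ b [] [] r r<0 = r<0
  replicate≤√ b (a ∷ L) (4b≤a ∷ 4b≤L) r (q₁ , 0≤q₁ , q₁²≤b , q₂ , 0≤q₂ , q₂²≤b , below) =
    q₁ + q₂ , +-mono-≤ 0≤q₁ 0≤q₂ , square≤a ,
    subst (λ s → Below s L) (shift r q₁ q₂) (replicate≤√ b L 4b≤L ((r - q₁) - q₂) below)
    where
    β : ℚ
    β = ℕ→ℚ b
    square≤a : (q₁ + q₂) * (q₁ + q₂) ≤ ℕ→ℚ a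
    square≤a = begin
      (q₁ + q₂) * (q₁ + q₂)                     ≤⟨ square-+-≤ q₁ q₂ ⟩
      (q₁ * q₁ + q₂ * q₂) + (q₁ * q₁ + q₂ * q₂) ≤⟨ +-mono-≤ (+-mono-≤ q₁²≤b q₂²≤b) (+-mono-≤ q₁²≤b q₂²≤b) ⟩
      (β + β) + (β + β)                         ≡⟨ solve 1 (λ β → (β :+ β) :+ (β :+ β) := con (ℕ→ℚ 4) :* β) refl β ⟩
      ℕ→ℚ 4 * β                                 ≡⟨ ℕ→ℚ-* 4 b ⟨
      ℕ→ℚ (4 ℕ.* b)                             ≤⟨ ℕ→ℚ-mono-≤ 4b≤a ⟩
      ℕ→ℚ a                                     ∎
      where open ≤-Reasoning
    shift : ∀ r p q → (r - p) - q ≡ r - (p + q)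
    shift = solve 3 (λ r p q → (r :- p) :- q := r :- (p :+ q)) refl

  ≤√replicate : ∀ b L → All (ℕ._≤ 4 ℕ.* b) L → L ≤√ replicate (length L ℕ.* 2) b
  ≤√replicate b [] [] r r<0 = r<0
  ≤√replicate b (a ∷ L) (a≤4b ∷ L≤4b) r (q , 0≤q , q²≤a , below) =
    h , 0≤h , h²≤b , h , 0≤h , h²≤b ,
    subst (λ s → Below s (replicate (length L ℕ.* 2) b)) (halve r q) (≤√replicate b L L≤4b (r - q) below)
    where
    h : ℚ
    h = q * ½
    0≤h : 0ℚ ≤ h
    0≤h = *-nonNeg 0≤q (nonNegative⁻¹ ½)
    h²≤b : h * h ≤ ℕ→ℚ b
    h²≤b = begin
      h * h                        ≡⟨ solve 1 (λ q → (q :* con ½) :* (q :* con ½) := (q :* q) :* con (½ * ½)) refl q ⟩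
      (q * q) * (½ * ½)            ≤⟨ *-monoʳ-≤-nonNeg (½ * ½) (≤-trans q²≤a (ℕ→ℚ-mono-≤ a≤4b)) ⟩
      ℕ→ℚ (4 ℕ.* b) * (½ * ½)      ≡⟨ cong (_* (½ * ½)) (ℕ→ℚ-* 4 b) ⟩
      (ℕ→ℚ 4 * ℕ→ℚ b) * (½ * ½)    ≡⟨ solve 1 (λ β → (con (ℕ→ℚ 4) :* β) :* con (½ * ½) := β) refl (ℕ→ℚ b) ⟩
      ℕ→ℚ b                        ∎
      where open ≤-Reasoning
    halve : ∀ r q → r - q ≡ (r - q * ½) - q * ½
    halve = solve 2 (λ r q → r :- q := (r :- q :* con ½) :- q :* con ½) refl

  module Denominator (Q : ℕ) .{{_ : ℕ.NonZero Q}} where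

    private
      0<Q : 0ℚ < ℕ→ℚ Q
      0<Q = ℕ→ℚ-mono-< (ℕ.>-nonZero⁻¹ Q)
      instance
        Q>0 : ℚ.Positive (ℕ→ℚ Q)
        Q>0 = ℚ.positive 0<Q
        Q≢0 : ℚ.NonZero (ℕ→ℚ Q)
        Q≢0 = pos⇒nonZero (ℕ→ℚ Q)
      t : ℚ
      t = 1/ ℕ→ℚ Q
      0<t : 0ℚ < t
      0<t = positive⁻¹ t {{1/pos⇒pos (ℕ→ℚ Q)}}
      Qt≡1 : ℕ→ℚ Q * t ≡ 1ℚ
      Qt≡1 = *-inverseʳ (ℕ→ℚ Q)

    infix 8 _/Q

    opaque
      _/Q : ℕ → ℚ
      m /Q = ℕ→ℚ m * t

      0/Q : 0 /Q ≡ 0ℚ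
      0/Q = *-zeroˡ t

      /Q-+ : ∀ m n → (m ℕ.+ n) /Q ≡ m /Q + n /Q
      /Q-+ m n = trans (cong (_* t) (ℕ→ℚ-+ m n)) (*-distribʳ-+ t (ℕ→ℚ m) (ℕ→ℚ n))

      /Q-mono-< : ∀ {m n} → m ℕ.< n → m /Q < n /Q
      /Q-mono-< {m} {n} m<n = *-monoˡ-<-pos t {{ℚ.positive 0<t}} {ℕ→ℚ m} {ℕ→ℚ n} (ℕ→ℚ-mono-< m<n)

      /Q-nonNeg : ∀ m → 0ℚ ≤ m /Q
      /Q-nonNeg m = *-nonNeg (ℕ→ℚ-mono-≤ {0} {m} z≤n) (<⇒≤ 0<t)

      private
        /Q-square : ∀ m → m /Q * m /Q ≡ ℕ→ℚ (m ℕ.* m) * (t * t)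
        /Q-square m = begin
          m /Q * m /Q                   ≡⟨ solve 2 (λ x t → (x :* t) :* (x :* t) := (x :* x) :* (t :* t)) refl (ℕ→ℚ m) t ⟩
          (ℕ→ℚ m * ℕ→ℚ m) * (t * t)     ≡⟨ cong (_* (t * t)) (ℕ→ℚ-* m m) ⟨
          ℕ→ℚ (m ℕ.* m) * (t * t)       ∎
          where open ≡-Reasoning

        ℕ→ℚ-rescale : ∀ a → ℕ→ℚ (a ℕ.* (Q ℕ.* Q)) * (t * t) ≡ ℕ→ℚ a
        ℕ→ℚ-rescale a = begin
          ℕ→ℚ (a ℕ.* (Q ℕ.* Q)) * (t * t)
            ≡⟨ cong (_* (t * t)) (trans (ℕ→ℚ-* a _) (cong (ℕ→ℚ a *_) (ℕ→ℚ-* Q Q))) ⟩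
          (ℕ→ℚ a * (ℕ→ℚ Q * ℕ→ℚ Q)) * (t * t)
            ≡⟨ solve 3 (λ a q t → (a :* (q :* q)) :* (t :* t) := a :* ((q :* t) :* (q :* t))) refl (ℕ→ℚ a) (ℕ→ℚ Q) t ⟩
          ℕ→ℚ a * ((ℕ→ℚ Q * t) * (ℕ→ℚ Q * t))   ≡⟨ cong (λ x → ℕ→ℚ a * (x * x)) Qt≡1 ⟩
          ℕ→ℚ a * (1ℚ * 1ℚ)                     ≡⟨ *-identityʳ (ℕ→ℚ a) ⟩
          ℕ→ℚ a                                 ∎
          where open ≡-Reasoning

        scale-mono-≤ : ∀ {a b} → a ℕ.≤ b → ℕ→ℚ a * (t * t) ≤ ℕ→ℚ b * (t * t)
        scale-mono-≤ {a} {b} a≤b =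
          *-monoʳ-≤-nonNeg (t * t) {{ℚ.nonNegative (square-nonNeg t)}} {ℕ→ℚ a} {ℕ→ℚ b} (ℕ→ℚ-mono-≤ a≤b)

      /Q-square-≤ : ∀ {m a} → m ℕ.* m ℕ.≤ a ℕ.* (Q ℕ.* Q) → m /Q * m /Q ≤ ℕ→ℚ a
      /Q-square-≤ {m} {a} le = subst₂ _≤_ (sym (/Q-square m)) (ℕ→ℚ-rescale a) (scale-mono-≤ le)

      ≤-/Q-square : ∀ {m a} → a ℕ.* (Q ℕ.* Q) ℕ.≤ m ℕ.* m → ℕ→ℚ a ≤ m /Q * m /Q
      ≤-/Q-square {m} {a} le = subst₂ _≤_ (ℕ→ℚ-rescale a) (sym (/Q-square m)) (scale-mono-≤ le)

    <⇒Below : (w : ℕ → ℕ) (L : List ℕ) → All (λ a → w a ℕ.* w a ℕ.≤ a ℕ.* (Q ℕ.* Q)) L →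
              ∀ r → r < sum (map w L) /Q → Below r L
    <⇒Below w [] [] r r<0 = subst (r <_) 0/Q r<0
    <⇒Below w (a ∷ L) (wa²≤a ∷ wL²≤L) r r<Σ =
      w a /Q , /Q-nonNeg (w a) , /Q-square-≤ {w a} {a} wa²≤a , <⇒Below w L wL²≤L (r - w a /Q) r-wa<ΣL
      where
      wa : ℚ
      wa = w a /Q
      ΣL : ℚ
      ΣL = sum (map w L) /Q
      r-wa<ΣL : r - wa < ΣL
      r-wa<ΣL = subst (r - wa <_) (solve 2 (λ x y → (x :+ y) :- x := y) refl wa ΣL)
                  (+-monoˡ-< (- wa) (subst (r <_) (/Q-+ (w a) (sum (map w L))) r<Σ))

    Below⇒< : (m : ℕ) (L : List ℕ) → All (λ a → a ℕ.* (Q ℕ.* Q) ℕ.≤ m ℕ.* m) L →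
              ∀ r → Below r L → r < (length L ℕ.* m) /Q
    Below⇒< m [] [] r r<0 = subst (r <_) (sym 0/Q) r<0
    Below⇒< m (a ∷ L) (a≤m² ∷ L≤m²) r (q , 0≤q , q²≤a , below) =
      subst₂ _<_ (solve 2 (λ r q → q :+ (r :- q) := r) refl r q) (sym (/Q-+ m (length L ℕ.* m)))
        (+-mono-≤-< q≤m (Below⇒< m L L≤m² (r - q) below))
      where
      q≤m : q ≤ m /Q
      q≤m = square-≤⇒≤ (/Q-nonNeg m) (≤-trans q²≤a (≤-/Q-square {m} {a} a≤m²))

  -- the solutions of the Pell equation P² + 1 = 2Q², with P/Q → √2
  pell : ℕ → ℕ × ℕ
  pell zero    = 1 , 1
  pell (suc m) = let (P , Q) = pell m in 3 ℕ.* P ℕ.+ 4 ℕ.* Q , 2 ℕ.* P ℕ.+ 3 ℕ.* Q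

  pell-equation : ∀ m → let (P , Q) = pell m in P ℕ.* P ℕ.+ 1 ≡ 2 ℕ.* (Q ℕ.* Q)
  pell-equation zero    = refl
  pell-equation (suc m) = begin
    (3 ℕ.* P ℕ.+ 4 ℕ.* Q) ℕ.* (3 ℕ.* P ℕ.+ 4 ℕ.* Q) ℕ.+ 1       ≡⟨ expand P Q ⟩
    (P ℕ.* P ℕ.+ 1) ℕ.+ 8 ℕ.* (P ℕ.* P ℕ.+ 3 ℕ.* (P ℕ.* Q) ℕ.+ 2 ℕ.* (Q ℕ.* Q))  ≡⟨ cong (ℕ._+ R) (pell-equation m) ⟩
    2 ℕ.* (Q ℕ.* Q) ℕ.+ 8 ℕ.* (P ℕ.* P ℕ.+ 3 ℕ.* (P ℕ.* Q) ℕ.+ 2 ℕ.* (Q ℕ.* Q))  ≡⟨ collect P Q ⟩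
    2 ℕ.* ((2 ℕ.* P ℕ.+ 3 ℕ.* Q) ℕ.* (2 ℕ.* P ℕ.+ 3 ℕ.* Q))   ∎
    where
    open ≡-Reasoning
    P : ℕ
    P = proj₁ (pell m)
    Q : ℕ
    Q = proj₂ (pell m)
    R : ℕ
    R = 8 ℕ.* (P ℕ.* P ℕ.+ 3 ℕ.* (P ℕ.* Q) ℕ.+ 2 ℕ.* (Q ℕ.* Q))
    expand : ∀ P Q → (3 ℕ.* P ℕ.+ 4 ℕ.* Q) ℕ.* (3 ℕ.* P ℕ.+ 4 ℕ.* Q) ℕ.+ 1
                   ≡ (P ℕ.* P ℕ.+ 1) ℕ.+ 8 ℕ.* (P ℕ.* P ℕ.+ 3 ℕ.* (P ℕ.* Q) ℕ.+ 2 ℕ.* (Q ℕ.* Q))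
    expand = solve-∀
    collect : ∀ P Q → 2 ℕ.* (Q ℕ.* Q) ℕ.+ 8 ℕ.* (P ℕ.* P ℕ.+ 3 ℕ.* (P ℕ.* Q) ℕ.+ 2 ℕ.* (Q ℕ.* Q))
                    ≡ 2 ℕ.* ((2 ℕ.* P ℕ.+ 3 ℕ.* Q) ℕ.* (2 ℕ.* P ℕ.+ 3 ℕ.* Q))
    collect = solve-∀

  pell-grows : ∀ m → m ℕ.< proj₂ (pell m)
  pell-grows zero    = s≤s z≤n
  pell-grows (suc m) = begin-strict
    suc m                          ≤⟨ pell-grows m ⟩
    Q                              <⟨ ℕ.m<m+n Q (ℕ.≤-<-trans z≤n (pell-grows m)) ⟩
    Q ℕ.+ Q                        ≤⟨ ℕ.m≤n+m (Q ℕ.+ Q) (2 ℕ.* P ℕ.+ Q) ⟩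
    (2 ℕ.* P ℕ.+ Q) ℕ.+ (Q ℕ.+ Q)  ≡⟨ regroup P Q ⟩
    2 ℕ.* P ℕ.+ 3 ℕ.* Q            ∎
    where
    open ℕ.≤-Reasoning
    P : ℕ
    P = proj₁ (pell m)
    Q : ℕ
    Q = proj₂ (pell m)
    regroup : ∀ P Q → (2 ℕ.* P ℕ.+ Q) ℕ.+ (Q ℕ.+ Q) ≡ 2 ℕ.* P ℕ.+ 3 ℕ.* Q
    regroup = solve-∀

  √2-approximation : ∀ k → ∃₂ λ P Q → P ℕ.* P ℕ.+ 1 ≡ 2 ℕ.* (Q ℕ.* Q) × k ℕ.+ 2 ℕ.* P ℕ.< 3 ℕ.* Q
  √2-approximation k =
    3 ℕ.* P ℕ.+ 4 ℕ.* Q , 2 ℕ.* P ℕ.+ 3 ℕ.* Q , pell-equation (suc k) ,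
    subst (k ℕ.+ 2P′ ℕ.<_) (regroup P Q) (ℕ.+-monoˡ-< 2P′ (pell-grows k))
    where
    P : ℕ
    P = proj₁ (pell k)
    Q : ℕ
    Q = proj₂ (pell k)
    2P′ : ℕ
    2P′ = 2 ℕ.* (3 ℕ.* P ℕ.+ 4 ℕ.* Q)
    regroup : ∀ P Q → Q ℕ.+ 2 ℕ.* (3 ℕ.* P ℕ.+ 4 ℕ.* Q) ≡ 3 ℕ.* (2 ℕ.* P ℕ.+ 3 ℕ.* Q)
    regroup = solve-∀

  sum-map-≥ : ∀ {d} (w : ℕ → ℕ) L → All (λ a → d ℕ.≤ w a) L → length L ℕ.* d ℕ.≤ sum (map w L)
  sum-map-≥ w []      []       = z≤n
  sum-map-≥ w (a ∷ L) (d≤w ∷ ds) = ℕ.+-mono-≤ d≤w (sum-map-≥ w L ds)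

  sum-map-≥-Any : ∀ {d e} (w : ℕ → ℕ) L → All (λ a → d ℕ.≤ w a) L → Any (λ a → e ℕ.≤ w a) L →
                  length L ℕ.* d ℕ.+ e ℕ.≤ sum (map w L) ℕ.+ d
  sum-map-≥-Any {d} {e} w (a ∷ L) (_ ∷ ds) (here e≤w) = begin
    (d ℕ.+ length L ℕ.* d) ℕ.+ e  ≡⟨ regroup d (length L ℕ.* d) e ⟩
    (e ℕ.+ length L ℕ.* d) ℕ.+ d  ≤⟨ ℕ.+-monoˡ-≤ d (ℕ.+-mono-≤ e≤w (sum-map-≥ w L ds)) ⟩
    sum (map w (a ∷ L)) ℕ.+ d     ∎
    where
    open ℕ.≤-Reasoning
    regroup : ∀ d n e → (d ℕ.+ n) ℕ.+ e ≡ (e ℕ.+ n) ℕ.+ d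
    regroup = solve-∀
  sum-map-≥-Any {d} {e} w (a ∷ L) (d≤w ∷ ds) (there any) = begin
    (d ℕ.+ length L ℕ.* d) ℕ.+ e  ≡⟨ ℕ.+-assoc d _ e ⟩
    d ℕ.+ (length L ℕ.* d ℕ.+ e)  ≤⟨ ℕ.+-mono-≤ d≤w (sum-map-≥-Any w L ds any) ⟩
    w a ℕ.+ (sum (map w L) ℕ.+ d) ≡⟨ ℕ.+-assoc (w a) _ d ⟨
    sum (map w (a ∷ L)) ℕ.+ d     ∎
    where open ℕ.≤-Reasoning

  pell-upper : ∀ {P Q} → P ℕ.* P ℕ.+ 1 ≡ 2 ℕ.* (Q ℕ.* Q) → 2 ℕ.* (Q ℕ.* Q) ℕ.≤ suc P ℕ.* suc P
  pell-upper {P} {Q} P²+1≡2Q² = begin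
    2 ℕ.* (Q ℕ.* Q)           ≡⟨ P²+1≡2Q² ⟨
    P ℕ.* P ℕ.+ 1             ≤⟨ ℕ.m≤m+n _ (2 ℕ.* P) ⟩
    P ℕ.* P ℕ.+ 1 ℕ.+ 2 ℕ.* P ≡⟨ square P ⟩
    suc P ℕ.* suc P           ∎
    where
    open ℕ.≤-Reasoning
    square : ∀ P → P ℕ.* P ℕ.+ 1 ℕ.+ 2 ℕ.* P ≡ suc P ℕ.* suc P
    square = solve-∀

  -- Q times a lower bound for √a when 8 ≤ a: 2P/Q < √8, and 3 = √9
  √lower : ℕ → ℕ → ℕ → ℕ
  √lower P Q a with 8 ℕ.<? a
  ... | yes _ = 3 ℕ.* Q
  ... | no  _ = 2 ℕ.* P

  √lower-square : ∀ {P Q} → P ℕ.* P ℕ.+ 1 ≡ 2 ℕ.* (Q ℕ.* Q) →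
                  ∀ {a} → 8 ℕ.≤ a → √lower P Q a ℕ.* √lower P Q a ℕ.≤ a ℕ.* (Q ℕ.* Q)
  √lower-square {P} {Q} P²+1≡2Q² {a} 8≤a with 8 ℕ.<? a
  ... | yes 8<a = ℕ.≤-trans (ℕ.≤-reflexive (nine Q)) (ℕ.*-monoˡ-≤ (Q ℕ.* Q) 8<a)
    where
    nine : ∀ Q → 3 ℕ.* Q ℕ.* (3 ℕ.* Q) ≡ 9 ℕ.* (Q ℕ.* Q)
    nine = solve-∀
  ... | no _ = begin
    2 ℕ.* P ℕ.* (2 ℕ.* P)     ≡⟨ four P ⟩
    4 ℕ.* (P ℕ.* P)           ≤⟨ ℕ.*-monoʳ-≤ 4 (ℕ.m≤m+n (P ℕ.* P) 1) ⟩
    4 ℕ.* (P ℕ.* P ℕ.+ 1)     ≡⟨ cong (4 ℕ.*_) P²+1≡2Q² ⟩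
    4 ℕ.* (2 ℕ.* (Q ℕ.* Q))   ≡⟨ ℕ.*-assoc 4 2 (Q ℕ.* Q) ⟨
    8 ℕ.* (Q ℕ.* Q)           ≤⟨ ℕ.*-monoˡ-≤ (Q ℕ.* Q) 8≤a ⟩
    a ℕ.* (Q ℕ.* Q)           ∎
    where
    open ℕ.≤-Reasoning
    four : ∀ P → 2 ℕ.* P ℕ.* (2 ℕ.* P) ≡ 4 ℕ.* (P ℕ.* P)
    four = solve-∀

  √lower-≥ : ∀ {P Q} → 2 ℕ.* P ℕ.≤ 3 ℕ.* Q → ∀ a → 2 ℕ.* P ℕ.≤ √lower P Q a
  √lower-≥ 2P≤3Q a with 8 ℕ.<? a
  ... | yes _ = 2P≤3Q
  ... | no  _ = ℕ.≤-refl

  √lower-> : ∀ {P Q a} → 8 ℕ.< a → 3 ℕ.* Q ℕ.≤ √lower P Q a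
  √lower-> {a = a} 8<a with 8 ℕ.<? a
  ... | yes _   = ℕ.≤-refl
  ... | no 8≮a = contradiction 8<a 8≮a

  -- one term above √8 outweighs the deficit 2(1 + P)/Q − 2P/Q of all the others
  sum-√lower : ∀ {P Q} L → length L ℕ.* 2 ℕ.+ 2 ℕ.* P ℕ.< 3 ℕ.* Q → Any (8 ℕ.<_) L →
               length L ℕ.* 2 ℕ.* suc P ℕ.< sum (map (√lower P Q) L)
  sum-√lower {P} {Q} L gap 8<L = ℕ.+-cancelʳ-< (2 ℕ.* P) _ _ (begin-strict
    n ℕ.* suc P ℕ.+ 2 ℕ.* P                      ≡⟨ regroup (length L) P ⟩
    (n ℕ.+ 2 ℕ.* P) ℕ.+ length L ℕ.* (2 ℕ.* P)   <⟨ ℕ.+-monoˡ-< _ gap ⟩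
    3 ℕ.* Q ℕ.+ length L ℕ.* (2 ℕ.* P)           ≡⟨ ℕ.+-comm (3 ℕ.* Q) _ ⟩
    length L ℕ.* (2 ℕ.* P) ℕ.+ 3 ℕ.* Q           ≤⟨ sum-map-≥-Any (√lower P Q) L 2P≤√lower 3Q≤√lower ⟩
    sum (map (√lower P Q) L) ℕ.+ 2 ℕ.* P         ∎)
    where
    open ℕ.≤-Reasoning
    n : ℕ
    n = length L ℕ.* 2
    2P≤√lower : All (λ a → 2 ℕ.* P ℕ.≤ √lower P Q a) L
    2P≤√lower = All.tabulate λ {a} _ → √lower-≥ (ℕ.≤-trans (ℕ.m≤n+m (2 ℕ.* P) n) (ℕ.<⇒≤ gap)) a
    3Q≤√lower : Any (λ a → 3 ℕ.* Q ℕ.≤ √lower P Q a) L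
    3Q≤√lower = Any.map (λ {a} → √lower-> {P} {Q} {a}) 8<L
    regroup : ∀ k P → k ℕ.* 2 ℕ.* suc P ℕ.+ 2 ℕ.* P ≡ (k ℕ.* 2 ℕ.+ 2 ℕ.* P) ℕ.+ k ℕ.* (2 ℕ.* P)
    regroup = solve-∀

  -- r = n(1 + P)/Q bounds the right-hand side n√2 from above, yet lies below the left-hand side
  ≰√replicate2 : ∀ L → All (8 ℕ.≤_) L → Any (8 ℕ.<_) L → ¬ (L ≤√ replicate (length L ℕ.* 2) 2)
  ≰√replicate2 L 8≤L 8<L L≤√ = separate (√2-approximation n)
    where
    n : ℕ
    n = length L ℕ.* 2
    separate : (∃₂ λ P Q → P ℕ.* P ℕ.+ 1 ≡ 2 ℕ.* (Q ℕ.* Q) × n ℕ.+ 2 ℕ.* P ℕ.< 3 ℕ.* Q) → ⊥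
    separate (P , zero      , _        , ())
    separate (P , Q@(suc _) , P²+1≡2Q² , gap) = <-irrefl refl r<r
      where
      open Denominator Q
      r : ℚ
      r = (n ℕ.* suc P) /Q
      r∈L : Below r L
      r∈L = <⇒Below (√lower P Q) L (All.map (√lower-square {P} {Q} P²+1≡2Q²) 8≤L) r (/Q-mono-< (sum-√lower L gap 8<L))
      r<r : r < r
      r<r = subst (λ m → r < (m ℕ.* suc P) /Q) (length-replicate n)
              (Below⇒< (suc P) (replicate n 2) (replicate⁺ n (pell-upper {P} {Q} P²+1≡2Q²)) r (L≤√ r r∈L))

module TwoTrees where

  open import Defs hiding (sym)
  open import Data.Nat as ℕ using (ℕ; zero; suc; z≤n; s≤s; _+_; _*_; _∸_; _^_; _≤_; _<_)
  import Data.Nat.Properties as ℕ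
  open import Data.Bool using (Bool; true; false; if_then_else_; not; _∧_; _∨_)
  import Data.Bool.Properties as Bool
  open import Data.Fin as Fin using (Fin; zero; suc)
  open import Data.Fin.Patterns using (0F; 1F; 2F)
  open import Data.Fin.Permutation as Perm using (Permutation′; _⟨$⟩ʳ_; _⟨$⟩ˡ_; _∘ₚ_; lift₀; transpose)
  open import Function.Construct.Identity using (↔-id)
  open import Function.Bundles using (Injection; mk↔ₛ′)
  open import Function.Properties.Inverse using (↔⇒↣)
  import Data.Fin.Properties as Fin
  open import Data.List using (List; []; _∷_; map; concatMap; length; tabulate; allFin)
  open import Data.List.Properties using (length-++)
  open import Data.Nat.ListAction using () renaming (sum to listSum)
  open import Data.List.Relation.Unary.All using (All; []; _∷_)
  open import Data.List.Relation.Unary.All.Properties using (concat⁺; concat⁻; map⁺; map⁻; tabulate⁺; tabulate⁻)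
  open import Algebra.Properties.CommutativeMonoid.Sum ℕ.+-0-commutativeMonoid
    using (sum-syntax; sum-cong-≗; ∑-distrib-+; ∑-comm; sum-permute; sum-replicate-zero)
  open import Data.Product using (_×_; _,_; proj₁; proj₂)
  open import Function using (_∘_; id)
  open import Relation.Nullary using (¬_; yes; no; contradiction)
  open import Relation.Nullary.Decidable using (Dec; ⌊_⌋; ⌊⌋-map′; isYes≗does; dec-true; dec-false)
  open import Relation.Binary.Definitions using (tri<; tri≈; tri>)
  open import Relation.Binary.PropositionalEquality
  open import Data.Nat.Tactic.RingSolver using (solve-∀)
  open import Level using (0ℓ)
  open import Relation.Binary.Bundles using (Setoid)
  import Relation.Binary.Reasoning.Setoid as SetoidReasoning

  ⟦_⟧ : Bool → ℕ
  ⟦ b ⟧ = if b then 1 else 0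

  sum-map-tabulate : ∀ {A : Set} {n} (f : A → ℕ) (g : Fin n → A) →
                     listSum (map f (tabulate g)) ≡ ∑[ i < n ] f (g i)
  sum-map-tabulate {n = zero}  f g = refl
  sum-map-tabulate {n = suc n} f g = cong (f (g zero) +_) (sum-map-tabulate f (g ∘ suc))

  length-concatMap : ∀ {A B : Set} (f : A → List B) xs → length (concatMap f xs) ≡ listSum (map (length ∘ f) xs)
  length-concatMap f []       = refl
  length-concatMap f (x ∷ xs) = trans (length-++ (f x)) (cong (length (f x) +_) (length-concatMap f xs))

  ∑-const : ∀ n c → ∑[ i < n ] c ≡ n * c
  ∑-const zero    c = refl
  ∑-const (suc n) c = cong (c +_) (∑-const n c)

  ∑-indicator : ∀ {n} (a : Fin n) → ∑[ j < n ] ⟦ ⌊ j Fin.≟ a ⌋ ⟧ ≡ 1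
  ∑-indicator {suc n} zero    = cong suc (sum-replicate-zero n)
  ∑-indicator {suc n} (suc a) = trans (sum-cong-≗ λ j → cong ⟦_⟧ (⌊⌋-map′ _ _ (j Fin.≟ a))) (∑-indicator a)

  deg-∑ : ∀ {n} (G : Graph n) v → deg G v ≡ ∑[ w < n ] ⟦ adj G v w ⟧
  deg-∑ G v = sum-map-tabulate (λ w → ⟦ adj G v w ⟧) id

  ∑deg : ∀ {n} → Graph n → ℕ
  ∑deg {n} G = ∑[ v < n ] deg G v

  nonEdge< : ∀ {n} → Graph n → Fin n → Fin n → Bool
  nonEdge< G u v = ⌊ u Fin.<? v ⌋ ∧ not (adj G u v)

  SOcoCell : ∀ {n} → Graph n → Fin n → Fin n → List ℕ
  SOcoCell G u v = if nonEdge< G u v then (deg G u ^ 2 + deg G v ^ 2) ∷ [] else []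

  length-SOcoTerms : ∀ {n} (G : Graph n) → length (SOcoTerms G) ≡ ∑[ u < n ] ∑[ v < n ] ⟦ nonEdge< G u v ⟧
  length-SOcoTerms {n} G = begin
    length (concatMap row (allFin n))            ≡⟨ length-concatMap row (allFin n) ⟩
    listSum (map (length ∘ row) (allFin n))      ≡⟨ sum-map-tabulate (length ∘ row) id ⟩
    ∑[ u < n ] length (row u)                    ≡⟨ sum-cong-≗ length-row ⟩
    ∑[ u < n ] ∑[ v < n ] ⟦ nonEdge< G u v ⟧     ∎
    where
    open ≡-Reasoning
    row : Fin n → List ℕ
    row u = concatMap (SOcoCell G u) (allFin n)
    length-cell : ∀ u v → length (SOcoCell G u v) ≡ ⟦ nonEdge< G u v ⟧
    length-cell u v with nonEdge< G u v
    ... | true  = refl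
    ... | false = refl
    length-row : ∀ u → length (row u) ≡ ∑[ v < n ] ⟦ nonEdge< G u v ⟧
    length-row u = trans (length-concatMap (SOcoCell G u) (allFin n))
                         (trans (sum-map-tabulate (length ∘ SOcoCell G u) id) (sum-cong-≗ (length-cell u)))

  ⌊⌋-true : ∀ {A : Set} (d : Dec A) → A → ⌊ d ⌋ ≡ true
  ⌊⌋-true d a = trans (isYes≗does d) (dec-true d a)

  ⌊⌋-false : ∀ {A : Set} (d : Dec A) → ¬ A → ⌊ d ⌋ ≡ false
  ⌊⌋-false d ¬a = trans (isYes≗does d) (dec-false d ¬a)

  pair-partition : ∀ {n} (G : Graph n) u v →
                   ⟦ nonEdge< G u v ⟧ + ⟦ nonEdge< G v u ⟧ + ⟦ adj G u v ⟧ + ⟦ ⌊ v Fin.≟ u ⌋ ⟧ ≡ 1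
  pair-partition G u v with Fin.<-cmp u v
  ... | tri< u<v _ _
    rewrite ⌊⌋-true (u Fin.<? v) u<v | ⌊⌋-false (v Fin.<? u) (Fin.<-asym u<v) | ⌊⌋-false (v Fin.≟ u) (Fin.<⇒≢ u<v ∘ sym)
    with adj G u v
  ...   | true  = refl
  ...   | false = refl
  pair-partition G u u | tri≈ _ refl _
    rewrite ⌊⌋-false (u Fin.<? u) (Fin.<-irrefl refl) | ⌊⌋-true (u Fin.≟ u) refl | irrefl G u = refl
  pair-partition G u v | tri> _ _ v<u
    rewrite ⌊⌋-false (u Fin.<? v) (Fin.<-asym v<u) | ⌊⌋-true (v Fin.<? u) v<u | ⌊⌋-false (v Fin.≟ u) (Fin.<⇒≢ v<u)
          | Graph.sym G v u
    with adj G u v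
  ...   | true  = refl
  ...   | false = refl

  nonEdge-count : ∀ {n} (G : Graph n) → length (SOcoTerms G) * 2 + ∑deg G + n ≡ n * n
  nonEdge-count {n} G = begin
    length (SOcoTerms G) * 2 + ∑deg G + n
      ≡⟨ cong (λ k → k * 2 + ∑deg G + n) (length-SOcoTerms G) ⟩
    ∑∑ c * 2 + ∑deg G + n
      ≡⟨ cong₂ (λ x y → x + y + n) (trans (ℕ.*-comm (∑∑ c) 2) (cong (∑∑ c +_) (ℕ.+-identityʳ (∑∑ c)))) (sum-cong-≗ (deg-∑ G)) ⟩
    ∑∑ c + ∑∑ c + ∑∑ a + n
      ≡⟨ cong₂ (λ x y → ∑∑ c + x + ∑∑ a + y) (∑-comm {n} {n} c′) ∑∑-diagonal ⟨
    ∑∑ c + ∑∑ c′ + ∑∑ a + ∑∑ e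
      ≡⟨ trans (∑∑-+ _ e) (cong (_+ ∑∑ e) (trans (∑∑-+ _ a) (cong (_+ ∑∑ a) (∑∑-+ c c′)))) ⟨
    ∑∑ (λ u v → c u v + c′ u v + a u v + e u v)
      ≡⟨ sum-cong-≗ {n} (λ u → sum-cong-≗ {n} (pair-partition G u)) ⟩
    ∑∑ (λ _ _ → 1)
      ≡⟨ trans (sum-cong-≗ {n} λ _ → trans (∑-const n 1) (ℕ.*-identityʳ n)) (∑-const n n) ⟩
    n * n ∎
    where
    open ≡-Reasoning
    ∑∑ : (Fin n → Fin n → ℕ) → ℕ
    ∑∑ f = ∑[ u < n ] ∑[ v < n ] f u v
    ∑∑-+ : ∀ f g → ∑∑ (λ u v → f u v + g u v) ≡ ∑∑ f + ∑∑ g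
    ∑∑-+ f g = trans (sum-cong-≗ {n} λ u → ∑-distrib-+ (f u) (g u)) (∑-distrib-+ (λ u → ∑[ v < n ] f u v) _)
    c c′ a e : Fin n → Fin n → ℕ
    c u v = ⟦ nonEdge< G u v ⟧
    c′ u v = c v u
    a u v = ⟦ adj G u v ⟧
    e u v = ⟦ ⌊ v Fin.≟ u ⌋ ⟧
    ∑∑-diagonal : ∑∑ e ≡ n
    ∑∑-diagonal = trans (sum-cong-≗ {n} ∑-indicator) (trans (∑-const n 1) (ℕ.*-identityʳ n))

  adj-≗⇒≅ : ∀ {n} {G H : Graph n} → (∀ i j → adj G i j ≡ adj H i j) → G ≅ H
  adj-≗⇒≅ G≗H = ↔-id _ , G≗H

  ≅-sym : ∀ {n} {G H : Graph n} → G ≅ H → H ≅ G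
  ≅-sym {H = H} (σ , σ-adj) = Perm.flip σ , λ i j →
    sym (trans (σ-adj (σ ⟨$⟩ˡ i) (σ ⟨$⟩ˡ j)) (cong₂ (adj H) (Perm.inverseʳ σ) (Perm.inverseʳ σ)))

  ≅-trans : ∀ {n} {G H K : Graph n} → G ≅ H → H ≅ K → G ≅ K
  ≅-trans (σ , σ-adj) (τ , τ-adj) = σ ∘ₚ τ , λ i j → trans (σ-adj i j) (τ-adj (σ ⟨$⟩ʳ i) (σ ⟨$⟩ʳ j))

  ≅-setoid : ℕ → Setoid 0ℓ 0ℓ
  ≅-setoid n = record
    { Carrier       = Graph n
    ; _≈_           = _≅_
    ; isEquivalence = record
      { refl  = ↔-id _ , λ _ _ → refl
      ; sym   = λ {G} {H} → ≅-sym {G = G} {H}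
      ; trans = λ {G} {H} {K} → ≅-trans {G = G} {H} {K}
      }
    }

  module ≅-Reasoning {n} = SetoidReasoning (≅-setoid n)

  ≟-permute : ∀ {n} (σ : Permutation′ n) i j → ⌊ σ ⟨$⟩ʳ i Fin.≟ σ ⟨$⟩ʳ j ⌋ ≡ ⌊ i Fin.≟ j ⌋
  ≟-permute σ i j with i Fin.≟ j
  ... | yes refl = ⌊⌋-true (σ ⟨$⟩ʳ i Fin.≟ σ ⟨$⟩ʳ i) refl
  ... | no  i≢j  = ⌊⌋-false (σ ⟨$⟩ʳ i Fin.≟ σ ⟨$⟩ʳ j) (i≢j ∘ Injection.injective (↔⇒↣ σ))

  deg-≅ : ∀ {n} {G H : Graph n} (G≅H : G ≅ H) v → deg G v ≡ deg H (proj₁ G≅H ⟨$⟩ʳ v)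
  deg-≅ {n} {G} {H} (σ , σ-adj) v = begin
    deg G v                                  ≡⟨ deg-∑ G v ⟩
    ∑[ w < n ] ⟦ adj G v w ⟧                 ≡⟨ sum-cong-≗ {n} (cong ⟦_⟧ ∘ σ-adj v) ⟩
    ∑[ w < n ] ⟦ adj H (σ ⟨$⟩ʳ v) (σ ⟨$⟩ʳ w) ⟧ ≡⟨ sum-permute (λ w → ⟦ adj H (σ ⟨$⟩ʳ v) w ⟧) σ ⟨
    ∑[ w < n ] ⟦ adj H (σ ⟨$⟩ʳ v) w ⟧         ≡⟨ deg-∑ H (σ ⟨$⟩ʳ v) ⟨
    deg H (σ ⟨$⟩ʳ v)                         ∎
    where open ≡-Reasoning

  ∑deg-≅ : ∀ {n} {G H : Graph n} → G ≅ H → ∑deg G ≡ ∑deg H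
  ∑deg-≅ {n} {G} {H} G≅H@(σ , _) =
    trans (sum-cong-≗ {n} (deg-≅ {G = G} {H} G≅H)) (sym (sum-permute (deg H) σ))

  NonEdgeDegrees : ∀ {n} → (ℕ → Set) → Graph n → Set
  NonEdgeDegrees {n} P G = ∀ (u v : Fin n) → u ≢ v → adj G u v ≡ false → P (deg G u)

  NonEdgeDegrees-≅ : ∀ {n} {P : ℕ → Set} {G H : Graph n} → G ≅ H → NonEdgeDegrees P H → NonEdgeDegrees P G
  NonEdgeDegrees-≅ {P = P} {G} {H} G≅H@(σ , σ-adj) P-H u v u≢v uv∉G =
    subst P (sym (deg-≅ {G = G} {H} G≅H u))
      (P-H (σ ⟨$⟩ʳ u) (σ ⟨$⟩ʳ v) (u≢v ∘ Injection.injective (↔⇒↣ σ)) (trans (sym (σ-adj u v)) uv∉G))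

  extend-≅ : ∀ {n} {G H : Graph n} (G≅H : G ≅ H) a b →
             extend G a b ≅ extend H (proj₁ G≅H ⟨$⟩ʳ a) (proj₁ G≅H ⟨$⟩ʳ b)
  extend-≅ (σ , σ-adj) a b = lift₀ σ , λ where
    zero    zero    → refl
    zero    (suc j) → sym (cong₂ _∨_ (≟-permute σ j a) (≟-permute σ j b))
    (suc i) zero    → sym (cong₂ _∨_ (≟-permute σ i a) (≟-permute σ i b))
    (suc i) (suc j) → σ-adj i j

  extend-comm : ∀ {n} (G : Graph n) a b → extend G a b ≅ extend G b a
  extend-comm G a b = adj-≗⇒≅ {G = extend G a b} {extend G b a} λ where
    zero    zero    → refl
    zero    (suc j) → Bool.∨-comm ⌊ j Fin.≟ a ⌋ ⌊ j Fin.≟ b ⌋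
    (suc i) zero    → Bool.∨-comm ⌊ i Fin.≟ a ⌋ ⌊ i Fin.≟ b ⌋
    (suc i) (suc j) → refl

  All-SOcoTerms⁺ : ∀ {n} {R : ℕ → Set} (G : Graph n) →
                   (∀ u v → u Fin.< v → adj G u v ≡ false → R (deg G u ^ 2 + deg G v ^ 2)) →
                   All R (SOcoTerms G)
  All-SOcoTerms⁺ {R = R} G R-nonEdges =
    concat⁺ (map⁺ (tabulate⁺ λ u → concat⁺ (map⁺ (tabulate⁺ λ v → R-cell u v))))
    where
    R-cell : ∀ u v → All R (SOcoCell G u v)
    R-cell u v with u Fin.<? v | adj G u v in uv∈G
    ... | yes u<v | false = R-nonEdges u v u<v uv∈G ∷ []
    ... | yes _   | true  = []
    ... | no  _   | _     = []

  All-SOcoTerms⁻ : ∀ {n} {R : ℕ → Set} (G : Graph n) → All R (SOcoTerms G) →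
                   ∀ u v → u Fin.< v → adj G u v ≡ false → R (deg G u ^ 2 + deg G v ^ 2)
  All-SOcoTerms⁻ {R = R} G R-terms u v u<v uv∉G =
    R-cell (tabulate⁻ (map⁻ (concat⁻ (tabulate⁻ (map⁻ (concat⁻ R-terms)) u))) v)
    where
    R-cell : All R (SOcoCell G u v) → R (deg G u ^ 2 + deg G v ^ 2)
    R-cell rewrite ⌊⌋-true (u Fin.<? v) u<v | uv∉G = λ { (r ∷ []) → r }

  NonEdgeDegrees-ends : ∀ {n} {P : ℕ → Set} (G : Graph n) → NonEdgeDegrees P G →
                        ∀ u v → u ≢ v → adj G u v ≡ false → P (deg G u) × P (deg G v)
  NonEdgeDegrees-ends G P-G u v u≢v uv∉G = P-G u v u≢v uv∉G , P-G v u (u≢v ∘ sym) (trans (Graph.sym G v u) uv∉G)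

  SOcoTerms-≥8 : ∀ {n} (G : Graph n) → NonEdgeDegrees (2 ≤_) G → All (8 ≤_) (SOcoTerms G)
  SOcoTerms-≥8 G 2≤deg = All-SOcoTerms⁺ G λ u v u<v uv∉G →
    let (2≤u , 2≤v) = NonEdgeDegrees-ends {P = 2 ≤_} G 2≤deg u v (Fin.<⇒≢ u<v) uv∉G
    in ℕ.+-mono-≤ (ℕ.^-monoˡ-≤ 2 2≤u) (ℕ.^-monoˡ-≤ 2 2≤v)

  SOcoTerms-≤8 : ∀ {n} (G : Graph n) → NonEdgeDegrees (_≡ 2) G → All (_≤ 8) (SOcoTerms G)
  SOcoTerms-≤8 G deg≡2 = All-SOcoTerms⁺ G λ u v u<v uv∉G →
    let (u≡2 , v≡2) = NonEdgeDegrees-ends {P = _≡ 2} G deg≡2 u v (Fin.<⇒≢ u<v) uv∉G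
    in ℕ.≤-reflexive (cong₂ (λ x y → x ^ 2 + y ^ 2) u≡2 v≡2)

  squares-≤8 : ∀ {a b} → 2 ≤ a → 2 ≤ b → a ^ 2 + b ^ 2 ≤ 8 → a ≡ 2
  squares-≤8 {a} {b} 2≤a 2≤b a²+b²≤8 = ℕ.≤-antisym (ℕ.≮⇒≥ 2≮a) 2≤a
    where
    2≮a : ¬ 2 < a
    2≮a 3≤a = ℕ.<⇒≱ (ℕ.m≤m+n 9 4)
      (ℕ.≤-trans {3 ^ 2 + 2 ^ 2} (ℕ.+-mono-≤ (ℕ.^-monoˡ-≤ 2 3≤a) (ℕ.^-monoˡ-≤ 2 2≤b)) a²+b²≤8)

  SOcoTerms-≤8⇒ : ∀ {n} (G : Graph n) → NonEdgeDegrees (2 ≤_) G → All (_≤ 8) (SOcoTerms G) →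
                  NonEdgeDegrees (_≡ 2) G
  SOcoTerms-≤8⇒ G 2≤deg terms≤8 u v u≢v uv∉G =
    squares-≤8 (proj₁ 2≤ends) (proj₂ 2≤ends) term≤8
    where
    2≤ends : 2 ≤ deg G u × 2 ≤ deg G v
    2≤ends = NonEdgeDegrees-ends {P = 2 ≤_} G 2≤deg u v u≢v uv∉G
    term≤8 : deg G u ^ 2 + deg G v ^ 2 ≤ 8
    term≤8 with Fin.<-cmp u v
    ... | tri< u<v _ _ = All-SOcoTerms⁻ G terms≤8 u v u<v uv∉G
    ... | tri≈ _ u≡v _ = contradiction u≡v u≢v
    ... | tri> _ _ v<u = subst (_≤ 8) (ℕ.+-comm (deg G v ^ 2) _)
                           (All-SOcoTerms⁻ G terms≤8 v u v<u (trans (Graph.sym G v u) uv∉G))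

  adj⇒≢ : ∀ {n} (G : Graph n) {a b} → adj G a b ≡ true → a ≢ b
  adj⇒≢ G ab∈G refl = contradiction (trans (sym ab∈G) (irrefl G _)) λ ()

  ∑-endpoints : ∀ {n} {a b : Fin n} → a ≢ b → ∑[ j < n ] ⟦ ⌊ j Fin.≟ a ⌋ ∨ ⌊ j Fin.≟ b ⌋ ⟧ ≡ 2
  ∑-endpoints {n} {a} {b} a≢b =
    trans (sum-cong-≗ {n} ⟦∨⟧) (trans (∑-distrib-+ (λ j → ⟦ ⌊ j Fin.≟ a ⌋ ⟧) (λ j → ⟦ ⌊ j Fin.≟ b ⌋ ⟧))
                                      (cong₂ _+_ (∑-indicator a) (∑-indicator b)))
    where
    ⟦∨⟧ : ∀ j → ⟦ ⌊ j Fin.≟ a ⌋ ∨ ⌊ j Fin.≟ b ⌋ ⟧ ≡ ⟦ ⌊ j Fin.≟ a ⌋ ⟧ + ⟦ ⌊ j Fin.≟ b ⌋ ⟧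
    ⟦∨⟧ j with j Fin.≟ a | j Fin.≟ b
    ... | yes refl | yes refl = contradiction refl a≢b
    ... | yes _    | no  _    = refl
    ... | no  _    | yes _    = refl
    ... | no  _    | no  _    = refl

  deg-extend-new : ∀ {n} (G : Graph n) {a b} → adj G a b ≡ true → deg (extend G a b) zero ≡ 2
  deg-extend-new G {a} {b} ab∈G = trans (deg-∑ (extend G a b) zero) (∑-endpoints (adj⇒≢ G ab∈G))

  deg-extend-old : ∀ {n} (G : Graph n) a b i → deg (extend G a b) (suc i) ≡ ⟦ ⌊ i Fin.≟ a ⌋ ∨ ⌊ i Fin.≟ b ⌋ ⟧ + deg G i
  deg-extend-old G a b i =
    trans (deg-∑ (extend G a b) (suc i)) (cong (⟦ ⌊ i Fin.≟ a ⌋ ∨ ⌊ i Fin.≟ b ⌋ ⟧ +_) (sym (deg-∑ G i)))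

  ∑deg-extend : ∀ {n} (G : Graph n) {a b} → adj G a b ≡ true → ∑deg (extend G a b) ≡ 4 + ∑deg G
  ∑deg-extend {n} G {a} {b} ab∈G = cong₂ _+_ (deg-extend-new G ab∈G)
    (trans (sum-cong-≗ {n} (deg-extend-old G a b))
      (trans (∑-distrib-+ _ (deg G)) (cong (_+ ∑deg G) (∑-endpoints (adj⇒≢ G ab∈G)))))

  twoTree-∑deg : ∀ {n} {H : Graph n} → TwoTreeBuilt n H → ∑deg H + 6 ≡ 4 * n
  twoTree-∑deg base = refl
  twoTree-∑deg {suc n} (step {G = G} t a b ab∈G) =
    trans (cong (_+ 6) (∑deg-extend G ab∈G)) (trans (cong (4 +_) (twoTree-∑deg t)) (sym (ℕ.*-suc 4 n)))

  extend-deg≥2 : ∀ {n} {H : Graph n} → TwoTreeBuilt n H → ∀ {a b} → adj H a b ≡ true →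
                 ∀ v → 2 ≤ deg (extend H a b) v
  extend-deg≥2 {H = H} t ab∈H zero = ℕ.≤-reflexive (sym (deg-extend-new H ab∈H))
  extend-deg≥2 base {0F} {0F} () (suc _)
  extend-deg≥2 base {1F} {1F} () (suc _)
  extend-deg≥2 base {0F} {1F} _ (suc 0F) = ℕ.≤-refl
  extend-deg≥2 base {0F} {1F} _ (suc 1F) = ℕ.≤-refl
  extend-deg≥2 base {1F} {0F} _ (suc 0F) = ℕ.≤-refl
  extend-deg≥2 base {1F} {0F} _ (suc 1F) = ℕ.≤-refl
  extend-deg≥2 {H = H} (step t a′ b′ a′b′∈G) {a} {b} _ (suc i) =
    ℕ.≤-trans (extend-deg≥2 t a′b′∈G i)
      (ℕ.≤-trans (ℕ.m≤n+m (deg H i) ⟦ ⌊ i Fin.≟ a ⌋ ∨ ⌊ i Fin.≟ b ⌋ ⟧) (ℕ.≤-reflexive (sym (deg-extend-old H a b i))))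

  twoTree-deg≥2 : ∀ {n} {H : Graph n} → TwoTreeBuilt n H → NonEdgeDegrees (2 ≤_) H
  twoTree-deg≥2 base 0F 0F 0≢0 _  = contradiction refl 0≢0
  twoTree-deg≥2 base 1F 1F 1≢1 _  = contradiction refl 1≢1
  twoTree-deg≥2 base 0F 1F _   ()
  twoTree-deg≥2 base 1F 0F _   ()
  twoTree-deg≥2 (step t a b ab∈G) u _ _ _ = extend-deg≥2 t ab∈G u

  NonEdgeDegrees-unextend : ∀ {n} {H : Graph n} → TwoTreeBuilt n H → ∀ {a b} →
                            NonEdgeDegrees (_≡ 2) (extend H a b) → NonEdgeDegrees (_≡ 2) H
  NonEdgeDegrees-unextend {H = H} t {a} {b} ext-deg≡2 u v u≢v uv∉H =
    ℕ.≤-antisym deg≤2 (twoTree-deg≥2 t u v u≢v uv∉H)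
    where
    deg≤2 : deg H u ≤ 2
    deg≤2 = ℕ.≤-trans (ℕ.m≤n+m (deg H u) ⟦ ⌊ u Fin.≟ a ⌋ ∨ ⌊ u Fin.≟ b ⌋ ⟧)
              (ℕ.≤-reflexive (trans (sym (deg-extend-old H a b u)) (ext-deg≡2 (suc u) (suc v) (u≢v ∘ Fin.suc-injective) uv∉H)))

  deg-X-leaf : ∀ m (i : Fin m) → deg (X (2 + m)) (suc (suc i)) ≡ 2
  deg-X-leaf m i = trans (deg-∑ (X (2 + m)) (suc (suc i)))
    (cong (λ s → 1 + (1 + s)) (trans (sum-cong-≗ {m} λ j → cong ⟦_⟧ (Bool.∧-zeroʳ _)) (sum-replicate-zero m)))

  deg-X-hub : ∀ m (h : Fin (4 + m)) → Fin.toℕ h < 2 → 3 ≤ deg (X (4 + m)) h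
  deg-X-hub m 0F _ = subst (3 ≤_) (sym (deg-∑ (X (4 + m)) 0F)) (s≤s (s≤s (s≤s z≤n)))
  deg-X-hub m 1F _ = subst (3 ≤_) (sym (deg-∑ (X (4 + m)) 1F)) (s≤s (s≤s (s≤s z≤n)))
  deg-X-hub m (suc (suc _)) (s≤s (s≤s ()))

  X-nonEdgeDegrees : ∀ {n} → NonEdgeDegrees (_≡ 2) (X n)
  X-nonEdgeDegrees 0F 0F 0≢0 _ = contradiction refl 0≢0
  X-nonEdgeDegrees 1F 1F 1≢1 _ = contradiction refl 1≢1
  X-nonEdgeDegrees 0F (suc _) _ ()
  X-nonEdgeDegrees 1F 0F _ ()
  X-nonEdgeDegrees 1F (suc (suc _)) _ ()
  X-nonEdgeDegrees {suc (suc m)} (suc (suc i)) _ _ _ = deg-X-leaf m i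

  K2≅X2 : K2 ≅ X 2
  K2≅X2 = adj-≗⇒≅ {G = K2} {X 2} λ where
    0F 0F → refl
    0F 1F → refl
    1F 0F → refl
    1F 1F → refl

  rotate₃ : ∀ {m} → Permutation′ (3 + m)
  rotate₃ = mk↔ₛ′ forward backward forward∘backward backward∘forward
    where
    forward backward : ∀ {m} → Fin (3 + m) → Fin (3 + m)
    forward 0F = 2F
    forward 1F = 0F
    forward 2F = 1F
    forward (suc (suc (suc k))) = suc (suc (suc k))
    backward 0F = 1F
    backward 1F = 2F
    backward 2F = 0F
    backward (suc (suc (suc k))) = suc (suc (suc k))
    forward∘backward : ∀ {m} (i : Fin (3 + m)) → forward (backward i) ≡ i
    forward∘backward 0F = refl
    forward∘backward 1F = refl
    forward∘backward 2F = refl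
    forward∘backward (suc (suc (suc k))) = refl
    backward∘forward : ∀ {m} (i : Fin (3 + m)) → backward (forward i) ≡ i
    backward∘forward 0F = refl
    backward∘forward 1F = refl
    backward∘forward 2F = refl
    backward∘forward (suc (suc (suc k))) = refl

  extend-X-hubs : ∀ m → extend (X (2 + m)) 0F 1F ≅ X (3 + m)
  extend-X-hubs m = rotate₃ , rotate₃-adj
    where
    rotate₃-adj : ∀ i j → extAdj (X (2 + m)) 0F 1F i j ≡ XAdj (rotate₃ ⟨$⟩ʳ i) (rotate₃ ⟨$⟩ʳ j)
    rotate₃-adj 0F 0F = refl
    rotate₃-adj 0F 1F = refl
    rotate₃-adj 0F 2F = refl
    rotate₃-adj 0F (suc (suc (suc l))) = refl
    rotate₃-adj 1F 0F = refl
    rotate₃-adj 1F 1F = refl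
    rotate₃-adj 1F 2F = refl
    rotate₃-adj 1F (suc (suc (suc l))) = refl
    rotate₃-adj 2F 0F = refl
    rotate₃-adj 2F 1F = refl
    rotate₃-adj 2F 2F = refl
    rotate₃-adj 2F (suc (suc (suc l))) = refl
    rotate₃-adj (suc (suc (suc k))) 0F = refl
    rotate₃-adj (suc (suc (suc k))) 1F = refl
    rotate₃-adj (suc (suc (suc k))) 2F = refl
    rotate₃-adj (suc (suc (suc k))) (suc (suc (suc l))) =
      cong (λ b → not b ∧ false) (sym (⌊⌋-map′ _ _ (suc (suc k) Fin.≟ suc (suc l))))

  X3-complete : ∀ (i j : Fin 3) → XAdj i j ≡ not ⌊ i Fin.≟ j ⌋
  X3-complete 0F 0F = refl
  X3-complete 0F 1F = refl
  X3-complete 0F 2F = refl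
  X3-complete 1F 0F = refl
  X3-complete 1F 1F = refl
  X3-complete 1F 2F = refl
  X3-complete 2F 0F = refl
  X3-complete 2F 1F = refl
  X3-complete 2F 2F = refl

  X3-automorphism : Permutation′ 3 → X 3 ≅ X 3
  X3-automorphism π = π , λ i j →
    trans (X3-complete i j) (trans (cong not (sym (≟-permute π i j))) (sym (X3-complete _ _)))

  -- a hub h not joined to the new vertex keeps its degree n - 1 ≥ 3
  extend-X-hub-leaf : ∀ m {a b} (h : Fin (4 + m)) → Fin.toℕ h < 2 → ⌊ h Fin.≟ a ⌋ ∨ ⌊ h Fin.≟ b ⌋ ≡ false →
                      ¬ NonEdgeDegrees (_≡ 2) (extend (X (4 + m)) a b)
  extend-X-hub-leaf m {a} {b} h h<2 h∉ab deg≡2 =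
    ℕ.<-irrefl refl (ℕ.≤-trans (deg-X-hub m h h<2) (ℕ.≤-reflexive (begin
      deg (X (4 + m)) h                                  ≡⟨ cong (_+ deg (X (4 + m)) h) (cong ⟦_⟧ h∉ab) ⟨
      ⟦ ⌊ h Fin.≟ a ⌋ ∨ ⌊ h Fin.≟ b ⌋ ⟧ + deg (X (4 + m)) h ≡⟨ deg-extend-old (X (4 + m)) a b h ⟨
      deg (extend (X (4 + m)) a b) (suc h)                ≡⟨ deg≡2 (suc h) zero (λ ()) h∉ab ⟩
      2                                                  ∎)))
    where open ≡-Reasoning

  -- X 3 is a triangle, so every edge can be moved onto the hubs
  extend-X3 : ∀ (π : Permutation′ 3) a b → π ⟨$⟩ʳ a ≡ 0F → π ⟨$⟩ʳ b ≡ 1F → extend (X 3) a b ≅ X 4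
  extend-X3 π a b πa≡0 πb≡1 = begin
    extend (X 3) a b                   ≈⟨ extend-≅ (X3-automorphism π) a b ⟩
    extend (X 3) (π ⟨$⟩ʳ a) (π ⟨$⟩ʳ b) ≡⟨ cong₂ (extend (X 3)) πa≡0 πb≡1 ⟩
    extend (X 3) 0F 1F                 ≈⟨ extend-X-hubs 1 ⟩
    X 4                                ∎
    where open ≅-Reasoning

  extend-X : ∀ m a b → XAdj a b ≡ true → NonEdgeDegrees (_≡ 2) (extend (X (2 + m)) a b) →
             extend (X (2 + m)) a b ≅ X (3 + m)
  extend-X m 0F 0F () _
  extend-X m 1F 1F () _
  extend-X m 0F 1F _ _ = extend-X-hubs m
  extend-X m 1F 0F _ _ = begin
    extend (X (2 + m)) 1F 0F ≈⟨ extend-comm (X (2 + m)) 1F 0F ⟩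
    extend (X (2 + m)) 0F 1F ≈⟨ extend-X-hubs m ⟩
    X (3 + m)                ∎
    where open ≅-Reasoning
  extend-X 1 0F 2F _ _ = extend-X3 (transpose 1F 2F) 0F 2F refl refl
  extend-X 1 2F 1F _ _ = extend-X3 (transpose 0F 2F) 2F 1F refl refl
  extend-X 1 1F 2F _ _ = extend-X3 (transpose 0F 1F ∘ₚ transpose 1F 2F) 1F 2F refl refl
  extend-X 1 2F 0F _ _ = extend-X3 (transpose 0F 2F ∘ₚ transpose 1F 2F) 2F 0F refl refl
  extend-X (suc (suc m)) 0F (suc (suc j)) _ deg≡2 = contradiction deg≡2 (extend-X-hub-leaf m 1F (s≤s (s≤s z≤n)) refl)
  extend-X (suc (suc m)) 1F (suc (suc j)) _ deg≡2 = contradiction deg≡2 (extend-X-hub-leaf m 0F (s≤s z≤n) refl)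
  extend-X (suc (suc m)) (suc (suc i)) 0F _ deg≡2 = contradiction deg≡2 (extend-X-hub-leaf m 1F (s≤s (s≤s z≤n)) refl)
  extend-X (suc (suc m)) (suc (suc i)) 1F _ deg≡2 = contradiction deg≡2 (extend-X-hub-leaf m 0F (s≤s z≤n) refl)
  extend-X m (suc (suc i)) (suc (suc j)) leaves-adj _ =
    contradiction (trans (sym leaves-adj) (Bool.∧-zeroʳ _)) λ ()

  twoTree≅X : ∀ {n} {H : Graph n} → TwoTreeBuilt n H → NonEdgeDegrees (_≡ 2) H → H ≅ X n
  twoTree≅X base _ = K2≅X2
  twoTree≅X (step {zero} t () _ _) _
  twoTree≅X (step {1} {G} t 0F 0F aa∈G) _ = contradiction (trans (sym aa∈G) (irrefl G 0F)) λ ()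
  twoTree≅X (step {suc (suc m)} {G} t a b ab∈G) deg≡2 = begin
    extend G a b                   ≈⟨ G⁺≅X⁺ ⟩
    extend (X (2 + m)) (σ a) (σ b) ≈⟨ extend-X m (σ a) (σ b) (trans (sym (proj₂ G≅X a b)) ab∈G) X⁺-deg≡2 ⟩
    X (3 + m)                      ∎
    where
    open ≅-Reasoning
    G≅X : G ≅ X (2 + m)
    G≅X = twoTree≅X t (NonEdgeDegrees-unextend t deg≡2)
    σ : Fin (2 + m) → Fin (2 + m)
    σ = proj₁ G≅X ⟨$⟩ʳ_
    G⁺≅X⁺ : extend G a b ≅ extend (X (2 + m)) (σ a) (σ b)
    G⁺≅X⁺ = extend-≅ G≅X a b
    X⁺-deg≡2 : NonEdgeDegrees (_≡ 2) (extend (X (2 + m)) (σ a) (σ b))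
    X⁺-deg≡2 = NonEdgeDegrees-≅ {P = _≡ 2} {G = extend (X (2 + m)) (σ a) (σ b)} {H = extend G a b}
                 (≅-sym {G = extend G a b} {extend (X (2 + m)) (σ a) (σ b)} G⁺≅X⁺) deg≡2

  twoTree-nonEdges : ∀ {n} (G : Graph n) → 2 ≤ n → IsTwoTree G → (n ∸ 2) * (n ∸ 3) ≡ length (SOcoTerms G) * 2
  twoTree-nonEdges {n} G 2≤n (H , H-tt , G≅H) = ℕ.+-cancelʳ-≡ (5 * n) _ _ (begin
    (n ∸ 2) * (n ∸ 3) + 5 * n    ≡⟨ shape n 2≤n ⟩
    n * n + 6                    ≡⟨ cong (_+ 6) (nonEdge-count G) ⟨
    k + ∑deg G + n + 6           ≡⟨ regroup k (∑deg G) n ⟩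
    k + (∑deg G + 6) + n         ≡⟨ cong (λ s → k + s + n) degrees ⟩
    k + 4 * n + n                ≡⟨ collect k n ⟩
    k + 5 * n                    ∎)
    where
    open ≡-Reasoning
    k : ℕ
    k = length (SOcoTerms G) * 2
    degrees : ∑deg G + 6 ≡ 4 * n
    degrees = trans (cong (_+ 6) (∑deg-≅ {G = G} {H} G≅H)) (twoTree-∑deg H-tt)
    shape : ∀ n → 2 ≤ n → (n ∸ 2) * (n ∸ 3) + 5 * n ≡ n * n + 6
    shape 1 (s≤s ())
    shape 2 _ = refl
    shape (suc (suc (suc m))) _ = polynomial m
      where
      polynomial : ∀ m → suc m * m + 5 * (3 + m) ≡ (3 + m) * (3 + m) + 6
      polynomial = solve-∀
    regroup : ∀ k s n → k + s + n + 6 ≡ k + (s + 6) + n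
    regroup = solve-∀
    collect : ∀ k n → k + 4 * n + n ≡ k + 5 * n
    collect = solve-∀

  IsTwoTree-deg≥2 : ∀ {n} (G : Graph n) → IsTwoTree G → NonEdgeDegrees (2 ≤_) G
  IsTwoTree-deg≥2 G (H , H-tt , G≅H) = NonEdgeDegrees-≅ {P = 2 ≤_} {G} {H} G≅H (twoTree-deg≥2 H-tt)

  IsTwoTree≅X : ∀ {n} (G : Graph n) → IsTwoTree G → NonEdgeDegrees (_≡ 2) G → G ≅ X n
  IsTwoTree≅X {n} G (H , H-tt , G≅H) deg≡2 = begin
    G   ≈⟨ G≅H ⟩
    H   ≈⟨ twoTree≅X H-tt (NonEdgeDegrees-≅ {P = _≡ 2} {H} {G} (≅-sym {G = G} {H} G≅H) deg≡2) ⟩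
    X n ∎
    where open ≅-Reasoning

open import Defs hiding (sym)
open import Data.Nat as ℕ using (ℕ; _≤_; _*_; _∸_)
import Data.Nat.Properties as ℕ
open import Data.List using (List; replicate; length)
open import Data.List.Relation.Unary.All as All using (All)
open import Data.Product using (_×_; _,_)
open import Data.Sum using (inj₁; inj₂)
open import Function.Bundles using (_⇔_; mk⇔)
open import Relation.Nullary using (contradiction)
open import Relation.Binary.PropositionalEquality using (_≡_)
open SumsOfSquareRoots
open TwoTrees

mainTheorem6 : (n : ℕ) → 2 ≤ n → (G : Graph n) → IsTwoTree G →
    (replicate ((n ∸ 2) * (n ∸ 3)) 2 ≤√ SOcoTerms G)
    × ((SOcoTerms G ≈√ replicate ((n ∸ 2) * (n ∸ 3)) 2) ⇔ (G ≅ X n))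
mainTheorem6 n 2≤n G G-tt rewrite twoTree-nonEdges G 2≤n G-tt = lower-bound , mk⇔ equality⇒X X⇒equality
  where
  terms : List ℕ
  terms = SOcoTerms G
  terms≥8 : All (8 ≤_) terms
  terms≥8 = SOcoTerms-≥8 G (IsTwoTree-deg≥2 G G-tt)
  lower-bound : replicate (length terms * 2) 2 ≤√ terms
  lower-bound = replicate≤√ 2 terms terms≥8
  X⇒equality : G ≅ X n → terms ≈√ replicate (length terms * 2) 2
  X⇒equality G≅X =
    ≤√replicate 2 terms (SOcoTerms-≤8 G (NonEdgeDegrees-≅ {P = _≡ 2} {G} {X n} G≅X X-nonEdgeDegrees)) , lower-bound
  equality⇒X : terms ≈√ replicate (length terms * 2) 2 → G ≅ X n
  equality⇒X (terms≤√ , _) with All.decide (λ t → ℕ.≤-<-connex t 8) terms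
  ... | inj₁ terms≤8 = IsTwoTree≅X G G-tt (SOcoTerms-≤8⇒ G (IsTwoTree-deg≥2 G G-tt) terms≤8)
  ... | inj₂ some>8 = contradiction terms≤√ (≰√replicate2 terms terms≥8 some>8)
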